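{- Let $H$ be a finite set, with formal variables $h_b^U,h_b^L$ ($b\in H$) and $\beta$ subject to $h_b^U-h_b^L=\beta$. Fix a reference Stanley diagram $B:H\to\{U,L\}$, put $x_b=+1$ if $B_b=U$ and $x_b=-1$ if $B_b=L$, and $\ell_b:=x_b(h_b^U+h_b^L)$; for $I\subseteq H$ write $\ell_I=\prod_{b\in I}\ell_b$. For a Stanley sum $s=\sum_D c_D D$ ($c_D\in\mathbb{Z}$, $D:H\to\{U,L\}$) let $s':=\sum_D c_D\prod_{b\in H}x_b h_b^{D_b}$, and let $K_I^B=\sum_{D:\,D_I=B_I}c_D$. Then $$s'=2^{ -|H|}\sum_{I\subseteq H}\beta^{|I|}\,w_I\,\ell_{H\setminus I},\qquad w_J=w_J(K^B_\bullet):=(-1)^{|J|}\sum_{I\subseteq J}K_I^B\,(-2)^{|I|}.$$ Furthermore, for any other diagram $A$, $w_J(K^A_\bullet)=(-1)^{|\{j\in J:A_j\neq B_j\}|}\,w_J(K^B_\bullet)$.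
   Context: Stanley diagrams assign hook choices (upper $U$/lower $L$) to boxes; $\beta$ evaluates to $\alpha-1$, the difference of the upper and lower $\alpha$-hook lengths of a box. $K_I^B$ are the $K$-values of $s$ relative to $B$, and $w_J(K^A_\bullet)$ denotes the same formula applied to the $K$-values relative to $A$. -}

module Defs where

open import Level using (Level)
open import Data.Nat as ℕ using (ℕ; zero; suc)
open import Data.Integer as ℤ using (ℤ; +_; -[1+_])
open import Data.Fin using (Fin; zero; suc)
open import Data.Bool using (Bool; true; false; if_then_else_; _∧_; not)
open import Data.Vec using (Vec; []; _∷_; tabulate)
open import Data.List using (List; []; _∷_; map; _++_; filter)
open import Data.Product using (_×_; _,_)
open import Data.Fin.Subset using (Subset; ∣_∣; ∁; inside; outside; _∩_; ⊤)
open import Data.Fin.Subset.Properties using (_⊆?_)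
open import Algebra.Bundles using (CommutativeRing)

data Dir : Set where
  U L : Dir

_==Dir_ : Dir → Dir → Bool
U ==Dir U = true
L ==Dir L = true
_ ==Dir _ = false

Diagram : ℕ → Set
Diagram n = Fin n → Dir

-- A Stanley sum  Σ_D c_D D : a finite formal ℤ-linear combination of
-- diagrams, represented as a list of terms (c , D)
StanleySum : ℕ → Set
StanleySum n = List (ℤ × Diagram n)

allSubsets : ∀ n → List (Subset n)
allSubsets zero    = [] ∷ []
allSubsets (suc n) = map (outside ∷_) (allSubsets n) ++ map (inside ∷_) (allSubsets n)

subsetsOf : ∀ {n} → Subset n → List (Subset n)
subsetsOf {n} J = filter (_⊆? J) (allSubsets n)

sumℤ : List ℤ → ℤ
sumℤ []       = + 0
sumℤ (x ∷ xs) = x ℤ.+ sumℤ xs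

agreeOn : ∀ {n} → Subset n → Diagram n → Diagram n → Bool
agreeOn {zero}  []      D B = true
agreeOn {suc n} (i ∷ I) D B =
  (if i then D zero ==Dir B zero else true) ∧ agreeOn I (λ b → D (suc b)) (λ b → B (suc b))

K : ∀ {n} → StanleySum n → Diagram n → Subset n → ℤ
K []              B I = + 0
K ((c , D) ∷ s)   B I = if agreeOn I D B then c ℤ.+ K s B I else K s B I

w : ∀ {n} → (Subset n → ℤ) → Subset n → ℤ
w Kv J = (ℤ.- + 1) ℤ.^ ∣ J ∣ ℤ.* sumℤ (map (λ I → Kv I ℤ.* ((ℤ.- + 2) ℤ.^ ∣ I ∣)) (subsetsOf J))

disagree : ∀ {n} → Diagram n → Diagram n → Subset n
disagree A B = tabulate (λ b → not (A b ==Dir B b))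

xsign : Dir → ℤ
xsign U = + 1
xsign L = ℤ.- + 1

module RingDefs {c ℓ : Level} (R : CommutativeRing c ℓ) where
  open CommutativeRing R using (Carrier; 0#; 1#; _+_; _*_; -_)

  natR : ℕ → Carrier
  natR zero    = 0#
  natR (suc k) = 1# + natR k

  ι : ℤ → Carrier
  ι (+ k)      = natR k
  ι (-[1+ k ]) = - natR (suc k)

  powR : Carrier → ℕ → Carrier
  powR a zero    = 1#
  powR a (suc k) = a * powR a k

  sumR : List Carrier → Carrier
  sumR []       = 0#
  sumR (x ∷ xs) = x + sumR xs

  prodOver : ∀ {n} → Subset n → (Fin n → Carrier) → Carrier
  prodOver {zero}  []      f = 1#
  prodOver {suc n} (i ∷ I) f = (if i then f zero else 1#) * prodOver I (λ b → f (suc b))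

  module _ {n : ℕ} (hU hL : Fin n → Carrier) where

    hook : Dir → Fin n → Carrier
    hook U b = hU b
    hook L b = hL b

    s′ : Diagram n → StanleySum n → Carrier
    s′ B s = sumR (map (λ { (c , D) → ι c * prodOver ⊤ (λ b → ι (xsign (B b)) * hook (D b) b) }) s)

    ℓb : Diagram n → Fin n → Carrier
    ℓb B b = ι (xsign (B b)) * (hU b + hL b)

    rhs : Carrier → Diagram n → StanleySum n → Carrier
    rhs β B s = sumR (map (λ I → powR β ∣ I ∣ * ι (w (K s B) I) * prodOver (∁ I) (ℓb B)) (allSubsets n))

{-# OPTIONS --safe #-}
module Submission where

-- Write σ_b = ±1 according as D_b agrees with B_b or not. Since 2h^U = (h^U + h^L) + β and
-- 2h^L = (h^U + h^L) − β, every factor 2 x_b h_b^{D_b} equals ℓ_b + β σ_b, and expanding the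
-- product over H gives 2^|H| ∏_b x_b h_b^{D_b} = Σ_I β^|I| σ_I ℓ_{H∖I}. On the other side,
-- Σ_{I ⊆ J} [D_I = B_I] (−2)^|I| factorises as ∏_{j ∈ J} (1 − 2[D_j = B_j]) = (−1)^|J| σ_J,
-- so w_J(K^B) = Σ_D c_D σ_J(D, B); both sides are linear in s. Changing the reference
-- diagram multiplies σ_J(D, ·) by σ_J(A, B) = (−1)^|{j ∈ J : A_j ≠ B_j}|.

open import Defs
open import Level using (Level)
open import Function using (_∘_)
open import Data.Bool using (true; false; if_then_else_)
open import Data.Nat as ℕ using (ℕ; zero; suc)
open import Data.Integer as ℤ using (ℤ; +_; -[1+_])
import Data.Integer.Properties as ℤP
open import Data.Integer.Solver using (module +-*-Solver)
open import Data.Fin using (Fin; zero; suc)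
open import Data.Vec using ([]; _∷_)
open import Data.List using ([]; _∷_; map; _++_; filter)
import Data.List.Properties as List
open import Data.List.Relation.Unary.All using (universal)
open import Data.Fin.Subset using (Subset; ∣_∣; ∁; inside; outside; _∩_; _─_; ⊤)
open import Data.Fin.Subset.Properties using (_⊆?_; ⊆-max; ∣⊤∣≡n)
open import Data.Product using (_×_; _,_)
open import Relation.Nullary using (does)
open import Relation.Binary.PropositionalEquality as ≡ using (_≡_)
open import Algebra.Bundles using (CommutativeRing)
import Algebra.Properties.CommutativeSemigroup as CommutativeSemigroupProperties
import Algebra.Solver.Ring

module _ {n : ℕ} where
  open ≡ using (refl; cong; cong₂; trans)

  private
    filter-⊆∷-map-outside∷ : ∀ j (J : Subset n) Is →
      filter (_⊆? j ∷ J) (map (outside ∷_) Is) ≡ map (outside ∷_) (filter (_⊆? J) Is)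
    filter-⊆∷-map-outside∷ j J [] = refl
    filter-⊆∷-map-outside∷ j J (I ∷ Is) with does (I ⊆? J)
    ... | true  = cong (_ ∷_) (filter-⊆∷-map-outside∷ j J Is)
    ... | false = filter-⊆∷-map-outside∷ j J Is

    filter-⊆inside∷-map-inside∷ : ∀ (J : Subset n) Is →
      filter (_⊆? inside ∷ J) (map (inside ∷_) Is) ≡ map (inside ∷_) (filter (_⊆? J) Is)
    filter-⊆inside∷-map-inside∷ J [] = refl
    filter-⊆inside∷-map-inside∷ J (I ∷ Is) with does (I ⊆? J)
    ... | true  = cong (_ ∷_) (filter-⊆inside∷-map-inside∷ J Is)
    ... | false = filter-⊆inside∷-map-inside∷ J Is

    filter-⊆outside∷-map-inside∷ : ∀ (J : Subset n) Is →
      filter (_⊆? outside ∷ J) (map (inside ∷_) Is) ≡ []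
    filter-⊆outside∷-map-inside∷ J [] = refl
    filter-⊆outside∷-map-inside∷ J (I ∷ Is) = filter-⊆outside∷-map-inside∷ J Is

  subsetsOf-outside∷ : (J : Subset n) → subsetsOf (outside ∷ J) ≡ map (outside ∷_) (subsetsOf J)
  subsetsOf-outside∷ J = begin
    filter (_⊆? outside ∷ J) (map (outside ∷_) Is ++ map (inside ∷_) Is)
      ≡⟨ List.filter-++ (_⊆? outside ∷ J) (map (outside ∷_) Is) (map (inside ∷_) Is) ⟩
    filter (_⊆? outside ∷ J) (map (outside ∷_) Is)
      ++ filter (_⊆? outside ∷ J) (map (inside ∷_) Is)
      ≡⟨ cong₂ _++_ (filter-⊆∷-map-outside∷ outside J Is)
                    (filter-⊆outside∷-map-inside∷ J Is) ⟩
    map (outside ∷_) (subsetsOf J) ++ []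
      ≡⟨ List.++-identityʳ _ ⟩
    map (outside ∷_) (subsetsOf J) ∎
    where
    open ≡.≡-Reasoning
    Is = allSubsets n

  subsetsOf-inside∷ : (J : Subset n) →
    subsetsOf (inside ∷ J) ≡ map (outside ∷_) (subsetsOf J) ++ map (inside ∷_) (subsetsOf J)
  subsetsOf-inside∷ J =
    trans (List.filter-++ (_⊆? inside ∷ J) (map (outside ∷_) Is) (map (inside ∷_) Is))
          (cong₂ _++_ (filter-⊆∷-map-outside∷ inside J Is) (filter-⊆inside∷-map-inside∷ J Is))
    where Is = allSubsets n

  subsetsOf-⊤ : subsetsOf ⊤ ≡ allSubsets n
  subsetsOf-⊤ = List.filter-all (_⊆? ⊤) (universal ⊆-max (allSubsets n))

⊤─≡∁ : ∀ {n} (I : Subset n) → ⊤ ─ I ≡ ∁ I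
⊤─≡∁ []            = ≡.refl
⊤─≡∁ (inside ∷ I)  = ≡.cong (outside ∷_) (⊤─≡∁ I)
⊤─≡∁ (outside ∷ I) = ≡.cong (inside ∷_) (⊤─≡∁ I)

module SubsetSums {ℓ₁ ℓ₂ : Level} (R : CommutativeRing ℓ₁ ℓ₂) where
  open CommutativeRing R hiding (zero)
  open RingDefs R
  open import Relation.Binary.Reasoning.Setoid setoid
  private
    module +-CS = CommutativeSemigroupProperties +-commutativeSemigroup
    module *-CS = CommutativeSemigroupProperties *-commutativeSemigroup

  sumR-++ : ∀ xs ys → sumR (xs ++ ys) ≈ sumR xs + sumR ys
  sumR-++ []       ys = sym (+-identityˡ _)
  sumR-++ (x ∷ xs) ys = trans (+-congˡ (sumR-++ xs ys)) (sym (+-assoc _ _ _))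

  module _ {A : Set} where

    sumR-map-cong : ∀ {f g : A → Carrier} → (∀ x → f x ≈ g x) →
      ∀ xs → sumR (map f xs) ≈ sumR (map g xs)
    sumR-map-cong f≈g []       = refl
    sumR-map-cong f≈g (x ∷ xs) = +-cong (f≈g x) (sumR-map-cong f≈g xs)

    sumR-map-+ : ∀ (f g : A → Carrier) xs →
      sumR (map (λ x → f x + g x) xs) ≈ sumR (map f xs) + sumR (map g xs)
    sumR-map-+ f g []       = sym (+-identityˡ _)
    sumR-map-+ f g (x ∷ xs) = trans (+-congˡ (sumR-map-+ f g xs)) (+-CS.interchange _ _ _ _)

    sumR-map-*ˡ : ∀ k (f : A → Carrier) xs → sumR (map (λ x → k * f x) xs) ≈ k * sumR (map f xs)
    sumR-map-*ˡ k f []       = sym (zeroʳ k)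
    sumR-map-*ˡ k f (x ∷ xs) = trans (+-congˡ (sumR-map-*ˡ k f xs)) (sym (distribˡ k _ _))

    sumR-map-0 : ∀ {f : A → Carrier} → (∀ x → f x ≈ 0#) → ∀ xs → sumR (map f xs) ≈ 0#
    sumR-map-0 f≈0 []       = refl
    sumR-map-0 f≈0 (x ∷ xs) = trans (+-cong (f≈0 x) (sumR-map-0 f≈0 xs)) (+-identityˡ 0#)

  module _ {n : ℕ} (F : Subset (suc n) → Carrier) (J : Subset n) where

    sumR-subsetsOf-outside∷ :
      sumR (map F (subsetsOf (outside ∷ J))) ≈ sumR (map (F ∘ (outside ∷_)) (subsetsOf J))
    sumR-subsetsOf-outside∷ = reflexive (≡.cong sumR (≡.trans
      (≡.cong (map F) (subsetsOf-outside∷ J)) (≡.sym (List.map-∘ (subsetsOf J)))))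

    sumR-subsetsOf-inside∷ : sumR (map F (subsetsOf (inside ∷ J))) ≈
      sumR (map (F ∘ (outside ∷_)) (subsetsOf J)) + sumR (map (F ∘ (inside ∷_)) (subsetsOf J))
    sumR-subsetsOf-inside∷ = begin
      sumR (map F (subsetsOf (inside ∷ J)))
        ≡⟨ ≡.cong (sumR ∘ map F) (subsetsOf-inside∷ J) ⟩
      sumR (map F (map (outside ∷_) Is ++ map (inside ∷_) Is))
        ≡⟨ ≡.cong sumR (List.map-++ F (map (outside ∷_) Is) (map (inside ∷_) Is)) ⟩
      sumR (map F (map (outside ∷_) Is) ++ map F (map (inside ∷_) Is))
        ≈⟨ sumR-++ (map F (map (outside ∷_) Is)) (map F (map (inside ∷_) Is)) ⟩
      sumR (map F (map (outside ∷_) Is)) + sumR (map F (map (inside ∷_) Is))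
        ≡⟨ ≡.cong₂ (λ xs ys → sumR xs + sumR ys) (List.map-∘ Is) (List.map-∘ Is) ⟨
      sumR (map (F ∘ (outside ∷_)) Is) + sumR (map (F ∘ (inside ∷_)) Is) ∎
      where Is = subsetsOf J

  prodOver-cong : ∀ {n} (I : Subset n) {f g : Fin n → Carrier} →
    (∀ b → f b ≈ g b) → prodOver I f ≈ prodOver I g
  prodOver-cong []            f≈g = refl
  prodOver-cong (inside ∷ I)  f≈g = *-cong (f≈g zero) (prodOver-cong I (f≈g ∘ suc))
  prodOver-cong (outside ∷ I) f≈g = *-congˡ (prodOver-cong I (f≈g ∘ suc))

  prodOver-* : ∀ {n} (I : Subset n) (f g : Fin n → Carrier) →
    prodOver I (λ b → f b * g b) ≈ prodOver I f * prodOver I g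
  prodOver-* []            f g = sym (*-identityˡ 1#)
  prodOver-* (inside ∷ I)  f g =
    trans (*-congˡ (prodOver-* I (f ∘ suc) (g ∘ suc))) (*-CS.interchange _ _ _ _)
  prodOver-* (outside ∷ I) f g = begin
    1# * prodOver I (λ b → f (suc b) * g (suc b))   ≈⟨ *-identityˡ _ ⟩
    prodOver I (λ b → f (suc b) * g (suc b))        ≈⟨ prodOver-* I (f ∘ suc) (g ∘ suc) ⟩
    prodOver I (f ∘ suc) * prodOver I (g ∘ suc)     ≈⟨ *-cong (*-identityˡ _) (*-identityˡ _) ⟨
    (1# * prodOver I (f ∘ suc)) * (1# * prodOver I (g ∘ suc)) ∎

  prodOver-const : ∀ {n} (I : Subset n) a → prodOver I (λ _ → a) ≈ powR a ∣ I ∣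
  prodOver-const []            a = refl
  prodOver-const (inside ∷ I)  a = *-congˡ (prodOver-const I a)
  prodOver-const (outside ∷ I) a = trans (*-identityˡ _) (prodOver-const I a)

  prodOver-1 : ∀ {n} (I : Subset n) → prodOver I (λ _ → 1#) ≈ 1#
  prodOver-1 []            = refl
  prodOver-1 (inside ∷ I)  = trans (*-identityˡ _) (prodOver-1 I)
  prodOver-1 (outside ∷ I) = trans (*-identityˡ _) (prodOver-1 I)

  prodOver-+-expansion : ∀ {n} (J : Subset n) (f g : Fin n → Carrier) →
    prodOver J (λ b → f b + g b)
      ≈ sumR (map (λ I → prodOver I g * prodOver (J ─ I) f) (subsetsOf J))
  prodOver-+-expansion []            f g = sym (trans (+-identityʳ _) (*-identityˡ 1#))
  prodOver-+-expansion (outside ∷ J) f g = begin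
    1# * prodOver J (λ b → f′ b + g′ b)             ≈⟨ *-identityˡ _ ⟩
    prodOver J (λ b → f′ b + g′ b)                  ≈⟨ prodOver-+-expansion J f′ g′ ⟩
    sumR (map (λ I → prodOver I g′ * prodOver (J ─ I) f′) (subsetsOf J))
      ≈⟨ sumR-map-cong (λ I → *-cong (*-identityˡ _) (*-identityˡ _)) (subsetsOf J) ⟨
    sumR (map (term ∘ (outside ∷_)) (subsetsOf J))  ≈⟨ sumR-subsetsOf-outside∷ term J ⟨
    sumR (map term (subsetsOf (outside ∷ J)))       ∎
    where
    f′ = f ∘ suc
    g′ = g ∘ suc
    term = λ I → prodOver I g * prodOver ((outside ∷ J) ─ I) f
  prodOver-+-expansion (inside ∷ J) f g = begin
    (f zero + g zero) * P                           ≈⟨ distribʳ P (f zero) (g zero) ⟩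
    f zero * P + g zero * P                         ≈⟨ +-cong (*-congˡ expandP) (*-congˡ expandP) ⟩
    f zero * sumR (map rest Is) + g zero * sumR (map rest Is)
      ≈⟨ +-cong (sumR-map-*ˡ (f zero) rest Is) (sumR-map-*ˡ (g zero) rest Is) ⟨
    sumR (map (λ I → f zero * rest I) Is) + sumR (map (λ I → g zero * rest I) Is)
      ≈⟨ +-cong (sumR-map-cong without-zero Is) (sumR-map-cong with-zero Is) ⟩
    sumR (map (term ∘ (outside ∷_)) Is) + sumR (map (term ∘ (inside ∷_)) Is)
      ≈⟨ sumR-subsetsOf-inside∷ term J ⟨
    sumR (map term (subsetsOf (inside ∷ J)))        ∎
    where
    f′ = f ∘ suc
    g′ = g ∘ suc
    P = prodOver J (λ b → f′ b + g′ b)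
    Is = subsetsOf J
    rest = λ I → prodOver I g′ * prodOver (J ─ I) f′
    term = λ I → prodOver I g * prodOver ((inside ∷ J) ─ I) f
    expandP : P ≈ sumR (map rest Is)
    expandP = prodOver-+-expansion J f′ g′
    without-zero : ∀ I → f zero * rest I ≈ term (outside ∷ I)
    without-zero I = trans (*-CS.x∙yz≈y∙xz _ _ _) (*-congʳ (sym (*-identityˡ _)))
    with-zero : ∀ I → g zero * rest I ≈ term (inside ∷ I)
    with-zero I = trans (sym (*-assoc _ _ _)) (*-congˡ (sym (*-identityˡ _)))

  prodOver-agreeOn : ∀ {n} (I : Subset n) (D B : Diagram n) a →
    prodOver I (λ b → if D b ==Dir B b then a else 0#)
      ≈ (if agreeOn I D B then powR a ∣ I ∣ else 0#)
  prodOver-agreeOn []            D B a = refl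
  prodOver-agreeOn (outside ∷ I) D B a =
    trans (*-identityˡ _) (prodOver-agreeOn I (D ∘ suc) (B ∘ suc) a)
  prodOver-agreeOn (inside ∷ I)  D B a
    with D zero ==Dir B zero | agreeOn I (λ b → D (suc b)) (λ b → B (suc b))
       | prodOver-agreeOn I (D ∘ suc) (B ∘ suc) a
  ... | true  | true  | ih = *-congˡ ih
  ... | true  | false | ih = trans (*-congˡ ih) (zeroʳ a)
  ... | false | _     | _  = zeroˡ _

module _ where
  open import Data.Integer using (_+_; _*_; _^_; -_)

  module ℤ-Ring = RingDefs ℤP.+-*-commutativeRing
  module ℤ-SubsetSums = SubsetSums ℤP.+-*-commutativeRing

  ℤ∏ : ∀ {n} → Subset n → (Fin n → ℤ) → ℤ
  ℤ∏ = ℤ-Ring.prodOver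

  sgn : Dir → Dir → ℤ
  sgn d e = if d ==Dir e then + 1 else - + 1

  sgnOn : ∀ {n} → Subset n → Diagram n → Diagram n → ℤ
  sgnOn J D B = ℤ∏ J (λ b → sgn (D b) (B b))

  sumℤ≡sumR : ∀ xs → sumℤ xs ≡ ℤ-Ring.sumR xs
  sumℤ≡sumR []       = ≡.refl
  sumℤ≡sumR (x ∷ xs) = ≡.cong (_+_ x) (sumℤ≡sumR xs)

  powR≡^ : ∀ i k → ℤ-Ring.powR i k ≡ i ^ k
  powR≡^ i zero    = ≡.refl
  powR≡^ i (suc k) = ≡.cong (i *_) (powR≡^ i k)

  -1^k*-1^k≡1 : ∀ k → (- + 1) ^ k * (- + 1) ^ k ≡ + 1
  -1^k*-1^k≡1 zero    = ≡.refl
  -1^k*-1^k≡1 (suc k) =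
    ≡.trans (ℤ-*-CS.interchange (- + 1) ε (- + 1) ε) (≡.cong (+ 1 *_) (-1^k*-1^k≡1 k))
    where
    module ℤ-*-CS = CommutativeSemigroupProperties ℤP.*-commutativeSemigroup
    ε = (- + 1) ^ k

  one-plus-agreement-weight : ∀ x →
    + 1 + (if x then - + 2 else + 0) ≡ - + 1 * (if x then + 1 else - + 1)
  one-plus-agreement-weight true  = ≡.refl
  one-plus-agreement-weight false = ≡.refl

  sumR-subsetsOf-agreeOn : ∀ {n} (J : Subset n) (D B : Diagram n) →
    ℤ-Ring.sumR (map (λ I → if agreeOn I D B then (- + 2) ^ ∣ I ∣ else + 0) (subsetsOf J))
      ≡ (- + 1) ^ ∣ J ∣ * sgnOn J D B
  sumR-subsetsOf-agreeOn J D B = begin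
    sumR (map (λ I → if agreeOn I D B then (- + 2) ^ ∣ I ∣ else + 0) (subsetsOf J))
      ≡⟨ sumR-map-cong term≡ (subsetsOf J) ⟨
    sumR (map (λ I → ℤ∏ I weight * ℤ∏ (J ─ I) (λ _ → + 1)) (subsetsOf J))
      ≡⟨ prodOver-+-expansion J (λ _ → + 1) weight ⟨
    ℤ∏ J (λ b → + 1 + weight b)
      ≡⟨ prodOver-cong J (λ b → one-plus-agreement-weight (D b ==Dir B b)) ⟩
    ℤ∏ J (λ b → - + 1 * sgn (D b) (B b))
      ≡⟨ prodOver-* J (λ _ → - + 1) (λ b → sgn (D b) (B b)) ⟩
    ℤ∏ J (λ _ → - + 1) * sgnOn J D B
      ≡⟨ ≡.cong (_* sgnOn J D B)
                (≡.trans (prodOver-const J (- + 1)) (powR≡^ (- + 1) ∣ J ∣)) ⟩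
    (- + 1) ^ ∣ J ∣ * sgnOn J D B ∎
    where
    open ℤ-Ring
    open ℤ-SubsetSums
    open ≡.≡-Reasoning
    weight = λ b → if D b ==Dir B b then - + 2 else + 0
    term≡ : ∀ I → ℤ∏ I weight * ℤ∏ (J ─ I) (λ _ → + 1)
                    ≡ (if agreeOn I D B then (- + 2) ^ ∣ I ∣ else + 0)
    term≡ I = ≡.trans (≡.cong₂ _*_ (prodOver-agreeOn I D B (- + 2)) (prodOver-1 (J ─ I)))
      (≡.trans (ℤP.*-identityʳ (if agreeOn I D B then powR (- + 2) ∣ I ∣ else + 0))
        (≡.cong (λ p → if agreeOn I D B then p else + 0) (powR≡^ (- + 2) ∣ I ∣)))

  weightedK : ∀ {n} → StanleySum n → Diagram n → Subset n → ℤ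
  weightedK s B J = ℤ-Ring.sumR (map (λ I → K s B I * (- + 2) ^ ∣ I ∣) (subsetsOf J))

  K-∷-* : ∀ {n} c (D : Diagram n) s B I q →
    K ((c , D) ∷ s) B I * q ≡ c * (if agreeOn I D B then q else + 0) + K s B I * q
  K-∷-* c D s B I q with agreeOn I D B
  ... | true  = ℤP.*-distribʳ-+ q c (K s B I)
  ... | false = ≡.sym (≡.trans (≡.cong (_+ K s B I * q) (ℤP.*-zeroʳ c)) (ℤP.+-identityˡ _))

  weightedK-[] : ∀ {n} (B : Diagram n) J → weightedK [] B J ≡ + 0
  weightedK-[] B J = ℤ-SubsetSums.sumR-map-0 (λ I → ℤP.*-zeroˡ ((- + 2) ^ ∣ I ∣)) (subsetsOf J)

  weightedK-∷ : ∀ {n} c (D : Diagram n) s B J →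
    weightedK ((c , D) ∷ s) B J ≡ c * ((- + 1) ^ ∣ J ∣ * sgnOn J D B) + weightedK s B J
  weightedK-∷ c D s B J = begin
    sumR (map (λ I → K ((c , D) ∷ s) B I * q I) Is)
      ≡⟨ sumR-map-cong (λ I → K-∷-* c D s B I (q I)) Is ⟩
    sumR (map (λ I → c * agree I + K s B I * q I) Is)
      ≡⟨ sumR-map-+ (λ I → c * agree I) (λ I → K s B I * q I) Is ⟩
    sumR (map (λ I → c * agree I) Is) + weightedK s B J
      ≡⟨ ≡.cong (_+ weightedK s B J) (sumR-map-*ˡ c agree Is) ⟩
    c * sumR (map agree Is) + weightedK s B J
      ≡⟨ ≡.cong (λ x → c * x + weightedK s B J) (sumR-subsetsOf-agreeOn J D B) ⟩
    c * ((- + 1) ^ ∣ J ∣ * sgnOn J D B) + weightedK s B J ∎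
    where
    open ℤ-Ring
    open ℤ-SubsetSums
    open ≡.≡-Reasoning
    q = λ (I : Subset _) → (- + 2) ^ ∣ I ∣
    agree = λ I → if agreeOn I D B then q I else + 0
    Is = subsetsOf J

  w-K≡weightedK : ∀ {n} (s : StanleySum n) B J →
    w (K s B) J ≡ (- + 1) ^ ∣ J ∣ * weightedK s B J
  w-K≡weightedK s B J =
    ≡.cong ((- + 1) ^ ∣ J ∣ *_)
           (sumℤ≡sumR (map (λ I → K s B I * (- + 2) ^ ∣ I ∣) (subsetsOf J)))

  w-K-[] : ∀ {n} (B : Diagram n) J → w (K [] B) J ≡ + 0
  w-K-[] B J = begin
    w (K [] B) J            ≡⟨ w-K≡weightedK [] B J ⟩
    ε * weightedK [] B J    ≡⟨ ≡.cong (ε *_) (weightedK-[] B J) ⟩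
    ε * + 0                 ≡⟨ ℤP.*-zeroʳ ε ⟩
    + 0                     ∎
    where
    open ≡.≡-Reasoning
    ε = (- + 1) ^ ∣ J ∣

  w-K-∷ : ∀ {n} c (D : Diagram n) s B J →
    w (K ((c , D) ∷ s) B) J ≡ c * sgnOn J D B + w (K s B) J
  w-K-∷ c D s B J = begin
    w (K ((c , D) ∷ s) B) J              ≡⟨ w-K≡weightedK ((c , D) ∷ s) B J ⟩
    ε * weightedK ((c , D) ∷ s) B J      ≡⟨ ≡.cong (ε *_) (weightedK-∷ c D s B J) ⟩
    ε * (c * (ε * σ) + weightedK s B J)
      ≡⟨ solve 4 (λ ε c σ v → ε :* (c :* (ε :* σ) :+ v) := (ε :* ε) :* (c :* σ) :+ ε :* v)
           ≡.refl ε c σ (weightedK s B J) ⟩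
    (ε * ε) * (c * σ) + ε * weightedK s B J
      ≡⟨ ≡.cong₂ _+_ (≡.trans (≡.cong (_* (c * σ)) (-1^k*-1^k≡1 ∣ J ∣))
                              (ℤP.*-identityˡ (c * σ)))
                     (≡.sym (w-K≡weightedK s B J)) ⟩
    c * σ + w (K s B) J                  ∎
    where
    open ≡.≡-Reasoning
    open +-*-Solver
    ε = (- + 1) ^ ∣ J ∣
    σ = sgnOn J D B

  sgn-trans : ∀ d a b → sgn d a ≡ sgn d b * sgn a b
  sgn-trans U U U = ≡.refl
  sgn-trans U U L = ≡.refl
  sgn-trans U L U = ≡.refl
  sgn-trans U L L = ≡.refl
  sgn-trans L U U = ≡.refl
  sgn-trans L U L = ≡.refl
  sgn-trans L L U = ≡.refl
  sgn-trans L L L = ≡.refl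

  sgnOn-trans : ∀ {n} (J : Subset n) (D A B : Diagram n) →
    sgnOn J D A ≡ sgnOn J D B * sgnOn J A B
  sgnOn-trans J D A B =
    ≡.trans (prodOver-cong J (λ b → sgn-trans (D b) (A b) (B b))) (prodOver-* J _ _)
    where open ℤ-SubsetSums

  sgnOn≡-1^disagree : ∀ {n} (J : Subset n) (A B : Diagram n) →
    sgnOn J A B ≡ (- + 1) ^ ∣ J ∩ disagree A B ∣
  sgnOn≡-1^disagree []            A B = ≡.refl
  sgnOn≡-1^disagree (outside ∷ J) A B =
    ≡.trans (ℤP.*-identityˡ _) (sgnOn≡-1^disagree J (A ∘ suc) (B ∘ suc))
  sgnOn≡-1^disagree (inside ∷ J)  A B with A zero ==Dir B zero
  ... | true  = ≡.trans (ℤP.*-identityˡ _) (sgnOn≡-1^disagree J (A ∘ suc) (B ∘ suc))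
  ... | false = ≡.cong (- + 1 *_) (sgnOn≡-1^disagree J (A ∘ suc) (B ∘ suc))

  w-K-reference-change : ∀ {n} (s : StanleySum n) (A B : Diagram n) J →
    w (K s A) J ≡ (- + 1) ^ ∣ J ∩ disagree A B ∣ * w (K s B) J
  w-K-reference-change [] A B J =
    ≡.trans (w-K-[] A J) (≡.sym (≡.trans (≡.cong (ε *_) (w-K-[] B J)) (ℤP.*-zeroʳ ε)))
    where ε = (- + 1) ^ ∣ J ∩ disagree A B ∣
  w-K-reference-change ((c , D) ∷ s) A B J = begin
    w (K ((c , D) ∷ s) A) J            ≡⟨ w-K-∷ c D s A J ⟩
    c * sgnOn J D A + w (K s A) J
      ≡⟨ ≡.cong₂ (λ x y → c * x + y)
           (≡.trans (sgnOn-trans J D A B) (≡.cong (σ *_) (sgnOn≡-1^disagree J A B)))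
           (w-K-reference-change s A B J) ⟩
    c * (σ * ε) + ε * w (K s B) J
      ≡⟨ solve 4 (λ c σ ε v → c :* (σ :* ε) :+ ε :* v := ε :* (c :* σ :+ v))
           ≡.refl c σ ε (w (K s B) J) ⟩
    ε * (c * σ + w (K s B) J)          ≡⟨ ≡.cong (ε *_) (w-K-∷ c D s B J) ⟨
    ε * w (K ((c , D) ∷ s) B) J        ∎
    where
    open ≡.≡-Reasoning
    open +-*-Solver
    ε = (- + 1) ^ ∣ J ∩ disagree A B ∣
    σ = sgnOn J D B

module IntegerEmbedding {ℓ₁ ℓ₂ : Level} (R : CommutativeRing ℓ₁ ℓ₂) where
  open CommutativeRing R hiding (zero)
  open RingDefs R
  open import Algebra.Properties.Ring ring using (-0#≈0#; -‿+-comm; -‿involutive; -‿distribˡ-*)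
  open import Algebra.Solver.Ring.AlmostCommutativeRing
    using (_-Raw-AlmostCommutative⟶_; fromCommutativeRing; Induced-equivalence)
  open import Relation.Binary.Definitions using (WeaklyDecidable)
  open import Relation.Nullary using (yes; no)
  open import Data.Maybe using (just; nothing)
  import Data.Nat.Properties as ℕP
  open import Relation.Binary.Reasoning.Setoid setoid
  private
    module +-CS = CommutativeSemigroupProperties +-commutativeSemigroup

  natR-+ : ∀ m n → natR (m ℕ.+ n) ≈ natR m + natR n
  natR-+ zero    n = sym (+-identityˡ _)
  natR-+ (suc m) n = trans (+-congˡ (natR-+ m n)) (sym (+-assoc _ _ _))

  ι-⊖ : ∀ m n → ι (m ℤ.⊖ n) ≈ natR m - natR n
  ι-⊖ m       zero    rewrite ℤP.⊖-≥ {m} {0} ℕ.z≤n =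
    sym (trans (+-congˡ -0#≈0#) (+-identityʳ _))
  ι-⊖ zero    (suc n) = sym (+-identityˡ _)
  ι-⊖ (suc m) (suc n) rewrite ℤP.[1+m]⊖[1+n]≡m⊖n m n = begin
    ι (m ℤ.⊖ n)                             ≈⟨ ι-⊖ m n ⟩
    natR m - natR n                         ≈⟨ +-identityˡ _ ⟨
    0# + (natR m - natR n)                  ≈⟨ +-congʳ (-‿inverseʳ 1#) ⟨
    (1# - 1#) + (natR m - natR n)           ≈⟨ +-CS.interchange _ _ _ _ ⟩
    (1# + natR m) + (- 1# - natR n)         ≈⟨ +-congˡ (-‿+-comm 1# (natR n)) ⟩
    (1# + natR m) - (1# + natR n)           ∎

  ι-+ : ∀ i j → ι (i ℤ.+ j) ≈ ι i + ι j
  ι-+ (+ m)    (+ n)    = natR-+ m n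
  ι-+ (+ m)    -[1+ n ] = ι-⊖ m (suc n)
  ι-+ -[1+ m ] (+ n)    = trans (ι-⊖ n (suc m)) (+-comm _ _)
  ι-+ -[1+ m ] -[1+ n ] = begin
    - (1# + natR (suc (m ℕ.+ n)))           ≡⟨ ≡.cong (-_ ∘ natR) (ℕP.+-suc (suc m) n) ⟨
    - natR (suc m ℕ.+ suc n)                ≈⟨ -‿cong (natR-+ (suc m) (suc n)) ⟩
    - (natR (suc m) + natR (suc n))         ≈⟨ -‿+-comm _ _ ⟨
    - natR (suc m) - natR (suc n)           ∎

  ι-‿ : ∀ i → ι (ℤ.- i) ≈ - ι i
  ι-‿ (+ zero)  = sym -0#≈0#
  ι-‿ (+ suc n) = refl
  ι-‿ -[1+ n ]  = sym (-‿involutive _)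

  ι-1 : ι (+ 1) ≈ 1#
  ι-1 = +-identityʳ 1#

  ι-*-natˡ : ∀ m j → ι (+ m ℤ.* j) ≈ natR m * ι j
  ι-*-natˡ zero    j = trans (reflexive (≡.cong ι (ℤP.*-zeroˡ j))) (sym (zeroˡ _))
  ι-*-natˡ (suc m) j = begin
    ι (+ suc m ℤ.* j)                       ≡⟨ ≡.cong ι (ℤP.suc-* (+ m) j) ⟩
    ι (j ℤ.+ + m ℤ.* j)                     ≈⟨ ι-+ j (+ m ℤ.* j) ⟩
    ι j + ι (+ m ℤ.* j)                     ≈⟨ +-cong (sym (*-identityˡ _)) (ι-*-natˡ m j) ⟩
    1# * ι j + natR m * ι j                 ≈⟨ distribʳ _ _ _ ⟨
    (1# + natR m) * ι j                     ∎

  ι-* : ∀ i j → ι (i ℤ.* j) ≈ ι i * ι j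
  ι-* (+ m)    j = ι-*-natˡ m j
  ι-* -[1+ m ] j = begin
    ι (-[1+ m ] ℤ.* j)                      ≡⟨ ≡.cong ι (ℤP.neg-distribˡ-* (+ suc m) j) ⟨
    ι (ℤ.- (+ suc m ℤ.* j))                 ≈⟨ ι-‿ (+ suc m ℤ.* j) ⟩
    - ι (+ suc m ℤ.* j)                     ≈⟨ -‿cong (ι-*-natˡ (suc m) j) ⟩
    - (natR (suc m) * ι j)                  ≈⟨ -‿distribˡ-* _ _ ⟩
    - natR (suc m) * ι j                    ∎

  ι-prodOver : ∀ {n} (I : Subset n) (f : Fin n → ℤ) → ι (ℤ∏ I f) ≈ prodOver I (ι ∘ f)
  ι-prodOver []            f = ι-1
  ι-prodOver (inside ∷ I)  f =
    trans (ι-* (f zero) (ℤ∏ I (f ∘ suc))) (*-congˡ (ι-prodOver I (f ∘ suc)))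
  ι-prodOver (outside ∷ I) f =
    trans (ι-* (+ 1) (ℤ∏ I (f ∘ suc))) (*-cong ι-1 (ι-prodOver I (f ∘ suc)))

  ι-morphism : ℤ.+-*-rawRing -Raw-AlmostCommutative⟶ fromCommutativeRing R
  ι-morphism = record
    { ⟦_⟧ = ι ; +-homo = ι-+ ; *-homo = ι-* ; -‿homo = ι-‿ ; 0-homo = refl ; 1-homo = ι-1 }

  _≟ℤ_ : WeaklyDecidable (Induced-equivalence ι-morphism)
  i ≟ℤ j with i ℤ.≟ j
  ... | yes ≡.refl = just refl
  ... | no _       = nothing

  module ℤ-CoefficientSolver =
    Algebra.Solver.Ring ℤ.+-*-rawRing (fromCommutativeRing R) ι-morphism _≟ℤ_

module HookExpansion {ℓ₁ ℓ₂ : Level} (R : CommutativeRing ℓ₁ ℓ₂) where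
  open CommutativeRing R hiding (zero)
  open RingDefs R
  open SubsetSums R
  open IntegerEmbedding R
  open ℤ-CoefficientSolver using (solve; _:=_; _:+_; _:*_; :-_; con)
  open import Relation.Binary.Reasoning.Setoid setoid
  private
    module *-CS = CommutativeSemigroupProperties *-commutativeSemigroup

  module _ {n : ℕ} (hU hL : Fin n → Carrier) {β : Carrier}
           (hU-hL≈β : ∀ b → hU b - hL b ≈ β) where

    twice-signed-hook : ∀ (B D : Diagram n) b →
      ι (+ 2) * (ι (xsign (B b)) * hook hU hL (D b) b) ≈ ℓb hU hL B b + β * ι (sgn (D b) (B b))
    twice-signed-hook B D b = trans (expand (B b) (D b)) (+-congˡ (*-congʳ (hU-hL≈β b)))
      where
      expand : ∀ e d → ι (+ 2) * (ι (xsign e) * hook hU hL d b)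
                         ≈ ι (xsign e) * (hU b + hL b) + (hU b - hL b) * ι (sgn d e)
      expand U U = solve 2 (λ u l → con (+ 2) :* (con (+ 1) :* u)
                                     := con (+ 1) :* (u :+ l) :+ (u :+ :- l) :* con (+ 1))
                     refl (hU b) (hL b)
      expand U L = solve 2 (λ u l → con (+ 2) :* (con (+ 1) :* l)
                                     := con (+ 1) :* (u :+ l) :+ (u :+ :- l) :* con ℤ.-1ℤ)
                     refl (hU b) (hL b)
      expand L U = solve 2 (λ u l → con (+ 2) :* (con ℤ.-1ℤ :* u)
                                     := con ℤ.-1ℤ :* (u :+ l) :+ (u :+ :- l) :* con ℤ.-1ℤ)
                     refl (hU b) (hL b)
      expand L L = solve 2 (λ u l → con (+ 2) :* (con ℤ.-1ℤ :* l)
                                     := con ℤ.-1ℤ :* (u :+ l) :+ (u :+ :- l) :* con (+ 1))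
                     refl (hU b) (hL b)

    diagram-expansion : ∀ (B D : Diagram n) →
      powR (ι (+ 2)) n * prodOver ⊤ (λ b → ι (xsign (B b)) * hook hU hL (D b) b)
        ≈ sumR (map (λ I → powR β ∣ I ∣ * ι (sgnOn I D B) * prodOver (∁ I) (ℓb hU hL B))
                    (allSubsets n))
    diagram-expansion B D = begin
      powR two n * prodOver ⊤ signedHook
        ≡⟨ ≡.cong (λ k → powR two k * prodOver ⊤ signedHook) (∣⊤∣≡n n) ⟨
      powR two ∣ ⊤ {n} ∣ * prodOver ⊤ signedHook
        ≈⟨ *-congʳ (prodOver-const (⊤ {n}) two) ⟨
      prodOver (⊤ {n}) (λ _ → two) * prodOver ⊤ signedHook
        ≈⟨ prodOver-* (⊤ {n}) (λ _ → two) signedHook ⟨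
      prodOver ⊤ (λ b → two * signedHook b)
        ≈⟨ prodOver-cong ⊤ (twice-signed-hook B D) ⟩
      prodOver ⊤ (λ b → ℓ b + βσ b)
        ≈⟨ prodOver-+-expansion ⊤ ℓ βσ ⟩
      sumR (map (λ I → prodOver I βσ * prodOver (⊤ ─ I) ℓ) (subsetsOf ⊤))
        ≡⟨ ≡.cong (sumR ∘ map (λ I → prodOver I βσ * prodOver (⊤ ─ I) ℓ)) subsetsOf-⊤ ⟩
      sumR (map (λ I → prodOver I βσ * prodOver (⊤ ─ I) ℓ) (allSubsets n))
        ≈⟨ sumR-map-cong (λ I → *-cong (prodOver-βσ I) (prodOver-⊤─ I)) (allSubsets n) ⟩
      sumR (map (λ I → powR β ∣ I ∣ * ι (sgnOn I D B) * prodOver (∁ I) ℓ) (allSubsets n)) ∎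
      where
      two = ι (+ 2)
      ℓ = ℓb hU hL B
      signedHook = λ b → ι (xsign (B b)) * hook hU hL (D b) b
      βσ = λ b → β * ι (sgn (D b) (B b))
      prodOver-⊤─ : ∀ I → prodOver (⊤ ─ I) ℓ ≈ prodOver (∁ I) ℓ
      prodOver-⊤─ I = reflexive (≡.cong (λ X → prodOver X ℓ) (⊤─≡∁ I))
      prodOver-βσ : ∀ I → prodOver I βσ ≈ powR β ∣ I ∣ * ι (sgnOn I D B)
      prodOver-βσ I = trans (prodOver-* I (λ _ → β) (ι ∘ λ b → sgn (D b) (B b)))
                            (*-cong (prodOver-const I β) (sym (ι-prodOver I (λ b → sgn (D b) (B b)))))

    scaled-s′≈rhs : ∀ (B : Diagram n) (s : StanleySum n) →
      powR (ι (+ 2)) n * s′ hU hL B s ≈ rhs hU hL β B s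
    scaled-s′≈rhs B [] = trans (zeroʳ _) (sym (sumR-map-0 vanish (allSubsets n)))
      where
      vanish : ∀ I → powR β ∣ I ∣ * ι (w (K [] B) I) * prodOver (∁ I) (ℓb hU hL B) ≈ 0#
      vanish I =
        trans (*-congʳ (trans (*-congˡ (reflexive (≡.cong ι (w-K-[] B I)))) (zeroʳ _))) (zeroˡ _)
    scaled-s′≈rhs B ((c , D) ∷ s) = begin
      P * (ι c * Π + s′ hU hL B s)
        ≈⟨ distribˡ P (ι c * Π) (s′ hU hL B s) ⟩
      P * (ι c * Π) + P * s′ hU hL B s
        ≈⟨ +-cong (*-CS.x∙yz≈y∙xz P (ι c) Π) (scaled-s′≈rhs B s) ⟩
      ι c * (P * Π) + rhs hU hL β B s
        ≈⟨ +-congʳ (*-congˡ (diagram-expansion B D)) ⟩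
      ι c * sumR (map termD Is) + sumR (map termS Is)
        ≈⟨ +-congʳ (sumR-map-*ˡ (ι c) termD Is) ⟨
      sumR (map (λ I → ι c * termD I) Is) + sumR (map termS Is)
        ≈⟨ sumR-map-+ (λ I → ι c * termD I) termS Is ⟨
      sumR (map (λ I → ι c * termD I + termS I) Is)
        ≈⟨ sumR-map-cong coefficient Is ⟩
      rhs hU hL β B ((c , D) ∷ s) ∎
      where
      P = powR (ι (+ 2)) n
      Π = prodOver ⊤ (λ b → ι (xsign (B b)) * hook hU hL (D b) b)
      Is = allSubsets n
      ℓ = ℓb hU hL B
      termD = λ I → powR β ∣ I ∣ * ι (sgnOn I D B) * prodOver (∁ I) ℓ
      termS = λ I → powR β ∣ I ∣ * ι (w (K s B) I) * prodOver (∁ I) ℓ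
      coefficient : ∀ I → ι c * termD I + termS I
                            ≈ powR β ∣ I ∣ * ι (w (K ((c , D) ∷ s) B) I) * prodOver (∁ I) ℓ
      coefficient I = sym (begin
        a * ι (w (K ((c , D) ∷ s) B) I) * p
          ≈⟨ *-congʳ (*-congˡ (reflexive (≡.cong ι (w-K-∷ c D s B I)))) ⟩
        a * ι (c ℤ.* σ ℤ.+ v) * p
          ≈⟨ *-congʳ (*-congˡ (trans (ι-+ (c ℤ.* σ) v) (+-congʳ (ι-* c σ)))) ⟩
        a * (ι c * ι σ + ι v) * p
          ≈⟨ solve 5 (λ a x y z p → a :* (x :* y :+ z) :* p := x :* (a :* y :* p) :+ a :* z :* p)
                   refl a (ι c) (ι σ) (ι v) p ⟩
        ι c * termD I + termS I ∎)
        where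
        a = powR β ∣ I ∣
        p = prodOver (∁ I) ℓ
        σ = sgnOn I D B
        v = w (K s B) I

mainTheorem9 : ∀ {c ℓ : Level} →
    ((R : CommutativeRing c ℓ) (n : ℕ) (B : Diagram n) (s : StanleySum n)
      (hU hL : Fin n → CommutativeRing.Carrier R) (β : CommutativeRing.Carrier R) →
      (∀ b → CommutativeRing._≈_ R (CommutativeRing._+_ R (hU b) (CommutativeRing.-_ R (hL b))) β) →
      CommutativeRing._≈_ R
        (CommutativeRing._*_ R (RingDefs.powR R (RingDefs.ι R (+ 2)) n) (RingDefs.s′ R hU hL B s))
        (RingDefs.rhs R hU hL β B s))
    × ((n : ℕ) (s : StanleySum n) (A B : Diagram n) (J : Subset n) →
      w (K s A) J ≡ (ℤ.- + 1) ℤ.^ ∣ J ∩ disagree A B ∣ ℤ.* w (K s B) J)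
mainTheorem9 =
    (λ R n B s hU hL β hU-hL≈β → HookExpansion.scaled-s′≈rhs R hU hL hU-hL≈β B s)
  , (λ n s A B J → w-K-reference-change s A B J)
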